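{- Let $G=(V,E)$ be a graph, let $\alpha<1$ and $\beta>1$, and let $A$ be a clustering of $V$ (e.g. the output of a clustering algorithm $A$ for a fixed ordering $\pi$) in which every non-singleton cluster $C$ has a designated pivot $v\in C$. If $C$ is an $(A,\alpha)$-poor cluster, then every node $u\in C$ that is neither $A$-light nor $A$-heavy is $(A,3\alpha\beta)$-poor.
   Context: For a node $u$, $d(u)$ denotes its degree in $G$, and for a set $S\subseteq V$, $d_S(u)$ denotes the number of neighbors of $u$ in $S$. For a node $u$, $C_A(u)$ is the cluster of $A$ containing $u$ and $p_A(u)$ is the pivot of that cluster. A node $u$ is $A$-light if $d_C(u)\le |C|/3$ where $C=C_A(u)$. A node $u$ is $A$-heavy if $d(u)\ge \beta|C|$ where $C=C_A(u)$. For a parameter $x>0$, a node $u$ is $(A,x)$-poor if $d(u)\le x\, d(p_A(u))$ and $u$ is not $A$-light. A cluster $C$ (with a pivot) is an $(A,\alpha)$-poor cluster if it contains at least one $(A,\alpha)$-poor node.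
   Formalization: The parameters α and β range over the rationals. -}

module Defs where

open import Data.Nat using (ℕ; _≤_; _*_)
open import Data.Fin using (Fin; _≟_)
open import Data.Fin.Subset using (Subset; _∩_; ∣_∣)
open import Data.Vec using (tabulate)
open import Data.Bool using (Bool; true; false)
open import Data.Integer using (+_)
open import Data.Product using (_×_)
open import Relation.Nullary using (¬_)
open import Relation.Nullary.Decidable using (⌊_⌋)
open import Relation.Binary.PropositionalEquality using (_≡_)
import Data.Rational as Q
open Q using (ℚ)

record Graph (n : ℕ) : Set where
  field
    adj     : Fin n → Fin n → Bool
    adj-sym : ∀ u v → adj u v ≡ adj v u
    adj-irr : ∀ u → adj u u ≡ false

-- A clustering of V = Fin n in which every cluster has a designated
-- pivot belonging to it: encoded as the map u ↦ p_A(u) with p_A(p_A(u)) = p_A(u).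
-- The clusters are the fibres of this map (singleton clusters: pivot = the node).
record Clustering (n : ℕ) : Set where
  field
    pivot      : Fin n → Fin n
    pivot-idem : ∀ u → pivot (pivot u) ≡ pivot u

module _ {n : ℕ} (G : Graph n) (A : Clustering n) where
  open Graph G
  open Clustering A

  nbrs : Fin n → Subset n
  nbrs u = tabulate (adj u)

  deg : Fin n → ℕ
  deg u = ∣ nbrs u ∣

  degIn : Subset n → Fin n → ℕ
  degIn S u = ∣ nbrs u ∩ S ∣

  cluster : Fin n → Subset n
  cluster u = tabulate (λ v → ⌊ pivot v ≟ pivot u ⌋)

  degℚ : Fin n → ℚ
  degℚ u = + deg u Q./ 1

  Light : Fin n → Set
  Light u = 3 * degIn (cluster u) u ≤ ∣ cluster u ∣

  Heavy : ℚ → Fin n → Set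
  Heavy β u = β Q.* (+ ∣ cluster u ∣ Q./ 1) Q.≤ degℚ u

  Poor : ℚ → Fin n → Set
  Poor x u = (degℚ u Q.≤ x Q.* degℚ (pivot u)) × ¬ Light u

-- If w ∈ C is not light then |C| < 3 d_C(w) ≤ 3 d(w), and if w is α-poor this is at most
-- 3α d(p).  A node u of the same cluster that is not heavy has d(u) < β |C|, so
-- d(u) < 3αβ d(p), where p is also the pivot of u.
module Submission where

open import Defs
open import Data.Nat using (ℕ)
open import Data.Fin using (Fin)
open import Data.Integer using (+_)
open import Data.Rational using (ℚ; _<_; _*_; _/_; 0ℚ; 1ℚ)
open import Relation.Nullary using (¬_)
open import Relation.Binary.PropositionalEquality using (_≡_)

open import Data.Fin using (_≟_)
open import Data.Fin.Subset using (∣_∣)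
open import Data.Fin.Subset.Properties using (p∩q⊆p; p⊆q⇒∣p∣≤∣q∣)
import Data.Integer.Properties as ℤ
import Data.Integer.Base as ℤ
import Data.Nat.Base as ℕ
open import Data.Nat.Coprimality using (1-coprimeTo) renaming (sym to coprime-sym)
import Data.Nat.Properties as ℕ
open import Data.Product using (_,_)
import Data.Rational.Base as ℚ
import Data.Rational.Properties as ℚ
open import Data.Rational.Solver using (module +-*-Solver)
open +-*-Solver using (solve; _:=_; _:*_)
open import Data.Vec using (tabulate)
open import Relation.Binary.PropositionalEquality using (refl; sym; cong)
open import Relation.Nullary.Decidable using (⌊_⌋)

fromℕ : ℕ → ℚ
fromℕ m = + m / 1

fromℕ≡mkℚ : ∀ m → fromℕ m ≡ ℚ.mkℚ (+ m) 0 (coprime-sym (1-coprimeTo m))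
fromℕ≡mkℚ m = ℚ.normalize-coprime (coprime-sym (1-coprimeTo m))

fromℕ-mono-< : ∀ {m n} → m ℕ.< n → fromℕ m < fromℕ n
fromℕ-mono-< {m} {n} m<n rewrite fromℕ≡mkℚ m | fromℕ≡mkℚ n =
  ℚ.*<* (ℤ.*-monoʳ-<-pos (+ 1) (ℤ.+<+ m<n))

fromℕ-* : ∀ m n → fromℕ (m ℕ.* n) ≡ fromℕ m * fromℕ n
fromℕ-* m n rewrite fromℕ≡mkℚ m | fromℕ≡mkℚ n = cong (_/ 1) (ℤ.pos-* m n)

1<p⇒positive : ∀ {p} → 1ℚ < p → ℚ.Positive p
1<p⇒positive 1<p = ℚ.positive (ℚ.<-trans (ℚ.positive⁻¹ 1ℚ) 1<p)

module _ {n : ℕ} (G : Graph n) (A : Clustering n) where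
  open Clustering A

  cluster-cong : ∀ {u w} → pivot u ≡ pivot w → cluster G A u ≡ cluster G A w
  cluster-cong = cong (λ p → tabulate (λ v → ⌊ pivot v ≟ p ⌋))

  degIn≤deg : ∀ S u → degIn G A S u ℕ.≤ deg G A u
  degIn≤deg S u = p⊆q⇒∣p∣≤∣q∣ (p∩q⊆p (nbrs G A u) S)

  ¬Light⇒∣cluster∣<3*deg : ∀ {u} → ¬ Light G A u → ∣ cluster G A u ∣ ℕ.< 3 ℕ.* deg G A u
  ¬Light⇒∣cluster∣<3*deg {u} ¬light =
    ℕ.<-≤-trans (ℕ.≰⇒> ¬light) (ℕ.*-monoʳ-≤ 3 (degIn≤deg (cluster G A u) u))

  ¬Heavy⇒deg<β*∣cluster∣ : ∀ β {u} → ¬ Heavy G A β u → degℚ G A u < β * fromℕ ∣ cluster G A u ∣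
  ¬Heavy⇒deg<β*∣cluster∣ β = ℚ.≰⇒>

lemma3p1 : {n : ℕ} (G : Graph n) (A : Clustering n) (α β : ℚ) →
    0ℚ < α → α < 1ℚ → 1ℚ < β →
    (w : Fin n) → Poor G A α w →
    (u : Fin n) → Clustering.pivot A u ≡ Clustering.pivot A w →
    ¬ Light G A u → ¬ Heavy G A β u →
    Poor G A ((+ 3 / 1) * α * β) u
lemma3p1 G A α β _ _ 1<β w (w-poor , w-notLight) u samePivot u-notLight u-notHeavy =
  bound , u-notLight
  where
  open Clustering A
  open ℚ.≤-Reasoning
  instance
    β-positive : ℚ.Positive β
    β-positive = 1<p⇒positive 1<β
    β-nonNeg : ℚ.NonNegative β
    β-nonNeg = ℚ.pos⇒nonNeg β
  three : ℚ
  three = fromℕ 3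
  d : Fin _ → ℚ
  d = degℚ G A
  bound : d u ℚ.≤ three * α * β * d (pivot u)
  bound = begin
    d u                               <⟨ ¬Heavy⇒deg<β*∣cluster∣ G A β u-notHeavy ⟩
    β * fromℕ ∣ cluster G A u ∣       ≡⟨ cong (λ C → β * fromℕ ∣ C ∣) (cluster-cong G A samePivot) ⟩
    β * fromℕ ∣ cluster G A w ∣       <⟨ ℚ.*-monoʳ-<-pos β (fromℕ-mono-< (¬Light⇒∣cluster∣<3*deg G A w-notLight)) ⟩
    β * fromℕ (3 ℕ.* deg G A w)       ≡⟨ cong (β *_) (fromℕ-* 3 (deg G A w)) ⟩
    β * (three * d w)                 ≤⟨ ℚ.*-monoˡ-≤-nonNeg β (ℚ.*-monoˡ-≤-nonNeg three w-poor) ⟩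
    β * (three * (α * d (pivot w)))   ≡⟨ solve 4 (λ b t a p → b :* (t :* (a :* p)) := t :* a :* b :* p)
                                                 refl β three α (d (pivot w)) ⟩
    three * α * β * d (pivot w)       ≡⟨ cong (λ p → three * α * β * d p) (sym samePivot) ⟩
    three * α * β * d (pivot u)       ∎
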